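{- Let $r\geqslant 3$ be an odd integer and let $\Gamma\cong\mathbb{Z}_{2r}\oplus\mathbb{Z}_2\oplus\mathbb{Z}_4$. Then there exists a zero-sum $\Gamma$-magic rectangle set $\mathrm{MRS}_\Gamma(r,8;2)$, i.e. two $r\times 8$ arrays with entries in $\Gamma$ such that every element of $\Gamma$ appears exactly once and in exactly one of the two arrays, and every row sum and every column sum of each array equals $0_\Gamma$. -}

module Defs where

open import Data.Nat using (ℕ; zero; suc; _*_; NonZero)
open import Data.Nat.DivMod using (_mod_)
open import Data.Fin using (Fin; toℕ; zero; suc)
import Data.Nat as ℕ
open import Data.Product using (_×_; _,_)
open import Function.Definitions using (Bijective)
open import Relation.Binary.PropositionalEquality using (_≡_)

_+ₘ_ : ∀ {n} → Fin n → Fin n → Fin n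
_+ₘ_ {suc n} a b = (toℕ a ℕ.+ toℕ b) mod (suc n)

Γ : ℕ → Set
Γ r = Fin (2 * r) × Fin 2 × Fin 4

-- the identity element of Γ (r = 0 gives the empty type, so we require r ≥ 1)
0Γ : (r : ℕ) → .{{NonZero r}} → Γ r
0Γ (suc r) = (zero , zero , zero)

_⊕_ : ∀ {r} → Γ r → Γ r → Γ r
_⊕_ {r} (a , b , c) (a' , b' , c') = (a +ₘ a' , b +ₘ b' , c +ₘ c')

ΣΓ : (r : ℕ) → .{{_ : NonZero r}} → (m : ℕ) → (Fin m → Γ r) → Γ r
ΣΓ r zero f = 0Γ r
ΣΓ r (suc m) f = _⊕_ {r} (f zero) (ΣΓ r m (λ i → f (suc i)))

record ZeroSumMRS (r : ℕ) .{{_ : NonZero r}} (a b c : ℕ) : Set where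
  field
    arr       : Fin c → Fin a → Fin b → Γ r
    bijective : Bijective {A = Fin c × Fin a × Fin b} _≡_ _≡_
                  (λ (k , i , j) → arr k i j)
    rowSum    : ∀ k i → ΣΓ r b (λ j → arr k i j) ≡ 0Γ r
    colSum    : ∀ k j → ΣΓ r a (λ i → arr k i j) ≡ 0Γ r

module Submission where

-- Since r is odd, Γ ≅ ℤ_r ⊕ H with H = ℤ₂ ⊕ ℤ₂ ⊕ ℤ₄, via (z, e, y, w) ↦ (2z + re, y, w).
-- Cell (k, i, j) of the two arrays gets ℤ_r-part i in the four left columns and −i in the
-- four right columns, and H-part T_i(k, j) for a 2 × 8 table T_i over H: T_0 = B, T_1 = A,
-- T_2 = C, and from then on E and A alternately.  Row sums vanish because 4i − 4i = 0 and every
-- table row sums to 0 in H; column sums vanish because Σ_{i<r} i ≡ 0 mod r for odd r and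
-- B + A + C = 0 = E + A entrywise.  Each table is a bijection onto H, and A, C and E all put
-- the same eight elements L into their left halves.  So the elements with ℤ_r-part c ≠ 0 are hit
-- exactly once: those with H-part in L by the left half of row c, the others by the right half
-- of row r − c; ℤ_r-part 0 is hit only by row 0.

open import Data.Bool using (Bool; true; false)
import Data.Bool as Bool
open import Data.Empty using (⊥-elim)
open import Data.Fin using (Fin; zero; suc; toℕ; punchOut)
open import Data.Fin.Patterns
open import Data.Fin.Properties using (all?)
import Data.Fin.Properties as Fin
open import Data.Nat using (ℕ; zero; suc; _+_; _*_; _∸_; _≤_; _<_; _<ᵇ_; _%_; _/_; NonZero; s≤s; z<s)
open import Data.Nat.DivMod
open import Data.Nat.Divisibility using (_∣_; divides; n∣m⇒m%n≡0; *-monoʳ-∣; m∣m*n; n∣m*n)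
open import Data.Nat.Properties
open import Data.Nat.Tactic.RingSolver using (solve-∀)
open import Data.Product using (_×_; _,_; ∃-syntax; proj₁; proj₂; uncurry)
open import Data.Product.Function.NonDependent.Propositional using (_×-↔_)
open import Data.Product.Properties using (≡-dec; ,-injective)
open import Data.Vec using (Vec; []; _∷_; lookup)
open import Function using (_∘_; _↔_; Inverse)
open import Function.Consequences.Propositional using (strictlySurjective⇒surjective)
open import Function.Definitions using (Injective; Surjective; StrictlySurjective)
open import Function.Properties.Inverse using (↔-refl; ↔-sym; ↔-trans)
open import Relation.Binary.Definitions using (DecidableEquality)
open import Relation.Binary.PropositionalEquality
  using (_≡_; _≢_; refl; sym; trans; cong; cong₂; subst; module ≡-Reasoning)
open import Relation.Nullary using (yes; no; contradiction)
open import Relation.Nullary.Decidable using (Dec; from-yes; _→-dec_)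

open import Defs

toℕ-mod : ∀ m n .{{_ : NonZero n}} → toℕ (m mod n) ≡ m % n
toℕ-mod m n = Fin.toℕ-fromℕ< (m%n<n m n)

mod-cong : ∀ m m' n .{{_ : NonZero n}} → m % n ≡ m' % n → m mod n ≡ m' mod n
mod-cong m m' n eq = Fin.fromℕ<-cong (m % n) (m' % n) eq (m%n<n m n) (m%n<n m' n)

toℕ-mod-self : ∀ {n} (i : Fin (suc n)) → toℕ i mod suc n ≡ i
toℕ-mod-self i = Fin.toℕ-injective (trans (toℕ-mod (toℕ i) _) (m<n⇒m%n≡m (Fin.toℕ<n i)))

[m%n+o]%n≡[m+o]%n : ∀ m o n .{{_ : NonZero n}} → (m % n + o) % n ≡ (m + o) % n
[m%n+o]%n≡[m+o]%n m o n = begin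
  (m % n + o) % n         ≡⟨ %-distribˡ-+ (m % n) o n ⟩
  (m % n % n + o % n) % n ≡⟨ cong (λ x → (x + o % n) % n) (m%n%n≡m%n m n) ⟩
  (m % n + o % n) % n     ≡⟨ %-distribˡ-+ m o n ⟨
  (m + o) % n             ∎
  where open ≡-Reasoning

+ₘ-mod : ∀ {n} a b → (a mod suc n) +ₘ (b mod suc n) ≡ (a + b) mod suc n
+ₘ-mod {n} a b = mod-cong (toℕ (a mod suc n) + toℕ (b mod suc n)) (a + b) (suc n) (begin
  (toℕ (a mod suc n) + toℕ (b mod suc n)) % suc n
    ≡⟨ cong₂ (λ x y → (x + y) % suc n) (toℕ-mod a _) (toℕ-mod b _) ⟩
  (a % suc n + b % suc n) % suc n
    ≡⟨ %-distribˡ-+ a b (suc n) ⟨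
  (a + b) % suc n
    ∎)
  where open ≡-Reasoning

+ₘ-identityʳ : ∀ {n} (a : Fin (suc n)) → a +ₘ zero ≡ a
+ₘ-identityʳ a = trans (cong (_mod _) (+-identityʳ (toℕ a))) (toℕ-mod-self a)

H : Set
H = Fin 2 × Fin 2 × Fin 4

infixr 6 _+H_
infix 4 _≟H_

_+H_ : H → H → H
(e , y , w) +H (e' , y' , w') = (e +ₘ e' , y +ₘ y' , w +ₘ w')

0H : H
0H = (0F , 0F , 0F)

_≟H_ : DecidableEquality H
_≟H_ = ≡-dec Fin._≟_ (≡-dec Fin._≟_ Fin._≟_)

+H-identityʳ : ∀ h → h +H 0H ≡ h
+H-identityʳ (e , y , w) = cong₂ _,_ (+ₘ-identityʳ e) (cong₂ _,_ (+ₘ-identityʳ y) (+ₘ-identityʳ w))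

ΣH : ∀ m → (Fin m → H) → H
ΣH zero    f = 0H
ΣH (suc m) f = f zero +H ΣH m (f ∘ suc)

∑ : ∀ m → (Fin m → ℕ) → ℕ
∑ zero    f = 0
∑ (suc m) f = f zero + ∑ m (f ∘ suc)

∑-suc : ∀ m (f : Fin m → ℕ) → ∑ m (suc ∘ f) ≡ m + ∑ m f
∑-suc zero    f = refl
∑-suc (suc m) f = cong suc (trans (cong (f zero +_) (∑-suc m (f ∘ suc))) (x+[y+z]≡y+[x+z] (f zero) m _))
  where
  x+[y+z]≡y+[x+z] : ∀ x y z → x + (y + z) ≡ y + (x + z)
  x+[y+z]≡y+[x+z] = solve-∀

∑-toℕ : ∀ n → 2 * ∑ n toℕ + n ≡ n * n
∑-toℕ zero    = refl
∑-toℕ (suc n) = begin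
  2 * ∑ n (suc ∘ toℕ) + suc n     ≡⟨ cong (λ s → 2 * s + suc n) (∑-suc n toℕ) ⟩
  2 * (n + ∑ n toℕ) + suc n       ≡⟨ regroup n (∑ n toℕ) ⟩
  (2 * ∑ n toℕ + n) + (2 * n + 1) ≡⟨ cong (_+ (2 * n + 1)) (∑-toℕ n) ⟩
  n * n + (2 * n + 1)             ≡⟨ square n ⟩
  suc n * suc n                   ∎
  where
  open ≡-Reasoning
  regroup : ∀ n s → 2 * (n + s) + suc n ≡ (2 * s + n) + (2 * n + 1)
  regroup = solve-∀
  square : ∀ n → n * n + (2 * n + 1) ≡ suc n * suc n
  square = solve-∀

∑-∸toℕ : ∀ n → 2 * ∑ n (λ i → n ∸ toℕ i) ≡ n * n + n
∑-∸toℕ zero    = refl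
∑-∸toℕ (suc n) = begin
  2 * (suc n + ∑ n (λ i → n ∸ toℕ i))   ≡⟨ *-distribˡ-+ 2 (suc n) _ ⟩
  2 * suc n + 2 * ∑ n (λ i → n ∸ toℕ i) ≡⟨ cong (2 * suc n +_) (∑-∸toℕ n) ⟩
  2 * suc n + (n * n + n)               ≡⟨ square n ⟩
  suc n * suc n + suc n                 ∎
  where
  open ≡-Reasoning
  square : ∀ n → 2 * suc n + (n * n + n) ≡ suc n * suc n + suc n
  square = solve-∀

odd⇒≡1+[n/2]*2 : ∀ n → n % 2 ≡ 1 → n ≡ 1 + n / 2 * 2
odd⇒≡1+[n/2]*2 n odd = trans (m≡m%n+[m/n]*n n 2) (cong (_+ n / 2 * 2) odd)

odd⇒∣∑toℕ : ∀ n → n % 2 ≡ 1 → n ∣ ∑ n toℕ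
odd⇒∣∑toℕ n odd = divides (n / 2)
  (*-cancelˡ-≡ _ _ 2 (+-cancelʳ-≡ n _ _ (trans (∑-toℕ n) (square (n / 2) (odd⇒≡1+[n/2]*2 n odd)))))
  where
  square : ∀ q {n} → n ≡ 1 + q * 2 → n * n ≡ 2 * (q * n) + n
  square q refl = solve q
    where
    solve : ∀ q → (1 + q * 2) * (1 + q * 2) ≡ 2 * (q * (1 + q * 2)) + (1 + q * 2)
    solve = solve-∀

odd⇒∣∑∸toℕ : ∀ n → n % 2 ≡ 1 → n ∣ ∑ n (λ i → n ∸ toℕ i)
odd⇒∣∑∸toℕ n odd = divides (1 + n / 2)
  (*-cancelˡ-≡ _ _ 2 (trans (∑-∸toℕ n) (square (n / 2) (odd⇒≡1+[n/2]*2 n odd))))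
  where
  square : ∀ q {n} → n ≡ 1 + q * 2 → n * n + n ≡ 2 * ((1 + q) * n)
  square q refl = solve q
    where
    solve : ∀ q → (1 + q * 2) * (1 + q * 2) + (1 + q * 2) ≡ 2 * ((1 + q) * (1 + q * 2))
    solve = solve-∀

-- Indexed by m with r = suc m, so that 0Γ r and _+ₘ_ on Fin (2 * r) compute.
module Embedding (m : ℕ) where

  r : ℕ
  r = suc m

  embed : ℕ → H → Γ r
  embed z (e , y , w) = (2 * z + r * toℕ e) mod (2 * r) , y , w

  [a+r*b]%2r≡[a+r*[b%2]]%2r : ∀ a b → (a + r * b) % (2 * r) ≡ (a + r * (b % 2)) % (2 * r)
  [a+r*b]%2r≡[a+r*[b%2]]%2r a b = begin
    (a + r * b) % (2 * r)
      ≡⟨ cong (λ b → (a + r * b) % (2 * r)) (m≡m%n+[m/n]*n b 2) ⟩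
    (a + r * (b % 2 + b / 2 * 2)) % (2 * r)
      ≡⟨ cong (_% (2 * r)) (regroup a r (b % 2) (b / 2)) ⟩
    (a + r * (b % 2) + b / 2 * (2 * r)) % (2 * r)
      ≡⟨ [m+kn]%n≡m%n (a + r * (b % 2)) (b / 2) (2 * r) ⟩
    (a + r * (b % 2)) % (2 * r)
      ∎
    where
    open ≡-Reasoning
    regroup : ∀ a r c q → a + r * (c + q * 2) ≡ a + r * c + q * (2 * r)
    regroup = solve-∀

  embed-+ : ∀ z z' h h' → _⊕_ {r} (embed z h) (embed z' h') ≡ embed (z + z') (h +H h')
  embed-+ z z' (e , y , w) (e' , y' , w') = cong (_, y +ₘ y' , w +ₘ w') (begin
    ((2 * z + r * toℕ e) mod (2 * r)) +ₘ ((2 * z' + r * toℕ e') mod (2 * r))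
      ≡⟨ +ₘ-mod (2 * z + r * toℕ e) (2 * z' + r * toℕ e') ⟩
    (2 * z + r * toℕ e + (2 * z' + r * toℕ e')) mod (2 * r)
      ≡⟨ cong (_mod (2 * r)) (regroup z z' r (toℕ e) (toℕ e')) ⟩
    (2 * (z + z') + r * (toℕ e + toℕ e')) mod (2 * r)
      ≡⟨ mod-cong (2 * (z + z') + r * (toℕ e + toℕ e')) (2 * (z + z') + r * ((toℕ e + toℕ e') % 2))
                  (2 * r) ([a+r*b]%2r≡[a+r*[b%2]]%2r (2 * (z + z')) (toℕ e + toℕ e')) ⟩
    (2 * (z + z') + r * ((toℕ e + toℕ e') % 2)) mod (2 * r)
      ≡⟨ cong (λ s → (2 * (z + z') + r * s) mod (2 * r)) (toℕ-mod (toℕ e + toℕ e') 2) ⟨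
    (2 * (z + z') + r * toℕ (e +ₘ e')) mod (2 * r)
      ∎)
    where
    open ≡-Reasoning
    regroup : ∀ z z' r e e' → 2 * z + r * e + (2 * z' + r * e') ≡ 2 * (z + z') + r * (e + e')
    regroup = solve-∀

  ΣΓ-embed : ∀ k (f : Fin k → ℕ) (g : Fin k → H) →
             ΣΓ r k (λ i → embed (f i) (g i)) ≡ embed (∑ k f) (ΣH k g)
  ΣΓ-embed zero    f g = sym (cong (λ x → x mod (2 * r) , 0F , 0F) (*-zeroʳ r))
  ΣΓ-embed (suc k) f g =
    trans (cong (_⊕_ {r} (embed (f zero) (g zero))) (ΣΓ-embed k (f ∘ suc) (g ∘ suc)))
          (embed-+ (f zero) (∑ k (f ∘ suc)) (g zero) (ΣH k (g ∘ suc)))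

  embed-vanishes : ∀ {z} → r ∣ z → embed z 0H ≡ 0Γ r
  embed-vanishes {z} r∣z = cong (_, 0F , 0F) (Fin.toℕ-injective (begin
    toℕ ((2 * z + r * 0) mod (2 * r)) ≡⟨ cong (λ x → toℕ ((2 * z + x) mod (2 * r))) (*-zeroʳ r) ⟩
    toℕ ((2 * z + 0) mod (2 * r))     ≡⟨ toℕ-mod (2 * z + 0) (2 * r) ⟩
    (2 * z + 0) % (2 * r)             ≡⟨ n∣m⇒m%n≡0 (2 * z + 0) (2 * r) 2r∣2z+0 ⟩
    0                                 ∎))
    where
    open ≡-Reasoning
    2r∣2z+0 : 2 * r ∣ 2 * z + 0
    2r∣2z+0 = subst (2 * r ∣_) (sym (+-identityʳ (2 * z))) (*-monoʳ-∣ 2 r∣z)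

  -- Adding r·e to x = 2z + re gives 2(z + re), whose half is z modulo r.
  decode : Γ r → ℕ × H
  decode (x , y , w) = ((toℕ x + r * (toℕ x % 2)) % (2 * r)) / 2 , toℕ x mod 2 , y , w

  module _ (r-odd : r % 2 ≡ 1) where

    parity-embed : ∀ z e → toℕ ((2 * z + r * toℕ e) mod (2 * r)) % 2 ≡ toℕ e
    parity-embed z e = begin
      toℕ ((2 * z + r * toℕ e) mod (2 * r)) % 2 ≡⟨ cong (_% 2) (toℕ-mod X (2 * r)) ⟩
      X % (2 * r) % 2                           ≡⟨ m∣n⇒o%n%m≡o%m 2 (2 * r) X (m∣m*n r) ⟩
      X % 2                                     ≡⟨ %-remove-+ˡ (r * toℕ e) (m∣m*n z) ⟩
      (r * toℕ e) % 2                           ≡⟨ %-distribˡ-* r (toℕ e) 2 ⟩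
      (r % 2 * (toℕ e % 2)) % 2                 ≡⟨ cong (λ x → (x * (toℕ e % 2)) % 2) r-odd ⟩
      (1 * (toℕ e % 2)) % 2                     ≡⟨ cong (_% 2) (*-identityˡ (toℕ e % 2)) ⟩
      toℕ e % 2 % 2                             ≡⟨ m%n%n≡m%n (toℕ e) 2 ⟩
      toℕ e % 2                                 ≡⟨ m<n⇒m%n≡m (Fin.toℕ<n e) ⟩
      toℕ e                                     ∎
      where
      open ≡-Reasoning
      X = 2 * z + r * toℕ e

    half-embed : ∀ z e → let x = toℕ ((2 * z + r * toℕ e) mod (2 * r)) in
                 ((x + r * (x % 2)) % (2 * r)) / 2 ≡ z % r
    half-embed z e = begin
      ((x + r * (x % 2)) % (2 * r)) / 2
        ≡⟨ cong (λ p → ((x + r * p) % (2 * r)) / 2) (parity-embed z e) ⟩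
      ((x + r * toℕ e) % (2 * r)) / 2
        ≡⟨ cong (λ y → ((y + r * toℕ e) % (2 * r)) / 2) (toℕ-mod X (2 * r)) ⟩
      ((X % (2 * r) + r * toℕ e) % (2 * r)) / 2
        ≡⟨ cong (_/ 2) ([m%n+o]%n≡[m+o]%n X (r * toℕ e) (2 * r)) ⟩
      ((X + r * toℕ e) % (2 * r)) / 2
        ≡⟨ cong (λ y → (y % (2 * r)) / 2) (double z r (toℕ e)) ⟩
      (((z + toℕ e * r) * 2) % (2 * r)) / 2
        ≡⟨ cong (_/ 2) (%-congʳ {o = (z + toℕ e * r) * 2} (*-comm 2 r)) ⟩
      (((z + toℕ e * r) * 2) % (r * 2)) / 2
        ≡⟨ cong (_/ 2) (m%n*o≡m*o%[n*o] (z + toℕ e * r) r 2) ⟨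
      ((z + toℕ e * r) % r * 2) / 2
        ≡⟨ m*n/n≡m ((z + toℕ e * r) % r) 2 ⟩
      (z + toℕ e * r) % r
        ≡⟨ [m+kn]%n≡m%n z (toℕ e) r ⟩
      z % r
        ∎
      where
      open ≡-Reasoning
      X = 2 * z + r * toℕ e
      x = toℕ (X mod (2 * r))
      double : ∀ z r e → 2 * z + r * e + r * e ≡ (z + e * r) * 2
      double = solve-∀

    decode-embed : ∀ z h → decode (embed z h) ≡ (z % r , h)
    decode-embed z (e , y , w) = cong₂ _,_ (half-embed z e) (cong (_, y , w) parity)
      where
      x = toℕ ((2 * z + r * toℕ e) mod (2 * r))
      parity : x mod 2 ≡ e
      parity = trans (mod-cong x (toℕ e) 2 (trans (parity-embed z e) (sym (m<n⇒m%n≡m (Fin.toℕ<n e)))))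
                     (toℕ-mod-self e)

    embed-injective : ∀ {z z' h h'} → embed z h ≡ embed z' h' → z % r ≡ z' % r × h ≡ h'
    embed-injective {z} {z'} {h} {h'} eq =
      ,-injective (trans (sym (decode-embed z h)) (trans (cong decode eq) (decode-embed z' h')))

Fin-injective⇒surjective : ∀ {n} {f : Fin n → Fin n} →
                           Injective _≡_ _≡_ f → StrictlySurjective _≡_ f
Fin-injective⇒surjective {suc n} {f} f-inj y with Fin.any? (λ x → f x Fin.≟ y)
... | yes fx≡y = fx≡y
... | no  fx≢y = contradiction (Fin.injective⇒≤ g-inj) 1+n≰n
  where
  y≢f : ∀ x → y ≢ f x
  y≢f x y≡fx = fx≢y (x , sym y≡fx)
  g : Fin (suc n) → Fin n
  g x = punchOut (y≢f x)
  g-inj : Injective _≡_ _≡_ g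
  g-inj {x} {x'} eq = f-inj (Fin.punchOut-injective (y≢f x) (y≢f x') eq)

injective⇒surjective : ∀ {n} {A B : Set} {f : A → B} → A ↔ Fin n → B ↔ Fin n →
                       Injective _≡_ _≡_ f → Surjective _≡_ _≡_ f
injective⇒surjective {f = f} A↔ B↔ f-inj = strictlySurjective⇒surjective surj
  where
  open Inverse
  F : Fin _ → Fin _
  F = to B↔ ∘ f ∘ from A↔
  F-inj : Injective _≡_ _≡_ F
  F-inj {x} {y} eq = begin
    x                 ≡⟨ strictlyInverseˡ A↔ x ⟨
    to A↔ (from A↔ x) ≡⟨ cong (to A↔) (f-inj (begin
      f (from A↔ x)       ≡⟨ strictlyInverseʳ B↔ _ ⟨
      from B↔ (F x)       ≡⟨ cong (from B↔) eq ⟩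
      from B↔ (F y)       ≡⟨ strictlyInverseʳ B↔ _ ⟩
      f (from A↔ y)       ∎)) ⟩
    to A↔ (from A↔ y) ≡⟨ strictlyInverseˡ A↔ y ⟩
    y                 ∎
    where open ≡-Reasoning
  surj : StrictlySurjective _≡_ f
  surj b with x , Fx≡b ← Fin-injective⇒surjective F-inj (to B↔ b) =
    from A↔ x ,
    trans (sym (strictlyInverseʳ B↔ _)) (trans (cong (from B↔) Fx≡b) (strictlyInverseʳ B↔ b))

Fin³↔ : ∀ {a b c} → (Fin a × Fin b × Fin c) ↔ Fin (a * (b * c))
Fin³↔ = ↔-sym (↔-trans Fin.*↔× (↔-refl ×-↔ Fin.*↔×))

triple-≡ : ∀ {A B C : Set} {a a' : A} {b b' : B} {c c' : C} →
           b ≡ b' → (a , c) ≡ (a' , c') → (a , b , c) ≡ (a' , b' , c')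
triple-≡ refl refl = refl

Table : Set
Table = Fin 2 → Fin 8 → H

fromRows : Vec (Vec H 8) 2 → Table
fromRows rows k j = lookup (lookup rows k) j

T-B : Table
T-B = fromRows
  ( ((0F , 0F , 0F) ∷ (0F , 0F , 1F) ∷ (0F , 0F , 3F) ∷ (1F , 1F , 2F)
   ∷ (1F , 0F , 3F) ∷ (1F , 0F , 0F) ∷ (1F , 0F , 1F) ∷ (0F , 1F , 2F) ∷ [])
  ∷ ((0F , 1F , 1F) ∷ (1F , 1F , 0F) ∷ (1F , 0F , 2F) ∷ (1F , 1F , 3F)
   ∷ (1F , 1F , 1F) ∷ (0F , 0F , 2F) ∷ (0F , 1F , 3F) ∷ (0F , 1F , 0F) ∷ [])
  ∷ [])

T-A : Table
T-A = fromRows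
  ( ((0F , 0F , 0F) ∷ (0F , 0F , 1F) ∷ (0F , 0F , 2F) ∷ (1F , 0F , 0F)
   ∷ (0F , 1F , 3F) ∷ (1F , 1F , 1F) ∷ (1F , 1F , 2F) ∷ (1F , 1F , 3F) ∷ [])
  ∷ ((0F , 0F , 3F) ∷ (0F , 1F , 0F) ∷ (0F , 1F , 2F) ∷ (1F , 1F , 0F)
   ∷ (0F , 1F , 1F) ∷ (1F , 0F , 1F) ∷ (1F , 0F , 2F) ∷ (1F , 0F , 3F) ∷ [])
  ∷ [])

T-C : Table
T-C = fromRows
  ( ((0F , 0F , 0F) ∷ (0F , 0F , 2F) ∷ (0F , 0F , 3F) ∷ (0F , 1F , 2F)
   ∷ (1F , 1F , 2F) ∷ (0F , 1F , 3F) ∷ (0F , 1F , 1F) ∷ (1F , 0F , 3F) ∷ [])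
  ∷ ((0F , 1F , 0F) ∷ (1F , 0F , 0F) ∷ (1F , 1F , 0F) ∷ (0F , 0F , 1F)
   ∷ (1F , 0F , 2F) ∷ (1F , 0F , 1F) ∷ (1F , 1F , 3F) ∷ (1F , 1F , 1F) ∷ [])
  ∷ [])

-- T-E is the negative of T-A.
T-E : Table
T-E = fromRows
  ( ((0F , 0F , 0F) ∷ (0F , 0F , 3F) ∷ (0F , 0F , 2F) ∷ (1F , 0F , 0F)
   ∷ (0F , 1F , 1F) ∷ (1F , 1F , 3F) ∷ (1F , 1F , 2F) ∷ (1F , 1F , 1F) ∷ [])
  ∷ ((0F , 0F , 1F) ∷ (0F , 1F , 0F) ∷ (0F , 1F , 2F) ∷ (1F , 1F , 0F)
   ∷ (0F , 1F , 3F) ∷ (1F , 0F , 3F) ∷ (1F , 0F , 2F) ∷ (1F , 0F , 1F) ∷ [])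
  ∷ [])

isLeft : Fin 8 → Bool
isLeft j = toℕ j <ᵇ 4

inL : H → Bool
inL (0F , 0F , _ ) = true
inL (0F , 1F , 0F) = true
inL (0F , 1F , 2F) = true
inL (1F , _  , 0F) = true
inL _              = false

Injectiveᵀ : Table → Set
Injectiveᵀ T = ∀ k j k' j' → T k j ≡ T k' j' → (k , j) ≡ (k' , j')

RowsVanish : Table → Set
RowsVanish T = ∀ k → ΣH 8 (T k) ≡ 0H

LeftHalfIsL : Table → Set
LeftHalfIsL T = ∀ k j → inL (T k j) ≡ isLeft j

injectiveᵀ? : ∀ T → Dec (Injectiveᵀ T)
injectiveᵀ? T = all? λ k → all? λ j → all? λ k' → all? λ j' →
  T k j ≟H T k' j' →-dec ≡-dec Fin._≟_ Fin._≟_ (k , j) (k' , j')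

rowsVanish? : ∀ T → Dec (RowsVanish T)
rowsVanish? T = all? λ k → ΣH 8 (T k) ≟H 0H

leftHalfIsL? : ∀ T → Dec (LeftHalfIsL T)
leftHalfIsL? T = all? λ k → all? λ j → inL (T k j) Bool.≟ isLeft j

B+A+C≡0 : ∀ k j → T-B k j +H (T-A k j +H T-C k j) ≡ 0H
B+A+C≡0 = from-yes (all? λ k → all? λ j → T-B k j +H (T-A k j +H T-C k j) ≟H 0H)

E+A≡0 : ∀ k j → T-E k j +H T-A k j ≡ 0H
E+A≡0 = from-yes (all? λ k → all? λ j → T-E k j +H T-A k j ≟H 0H)

alternating : ℕ → Table
alternating zero          = T-E
alternating (suc zero)    = T-A
alternating (suc (suc n)) = alternating n

rowTable : ℕ → Table
rowTable 0                   = T-B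
rowTable 1                   = T-A
rowTable 2                   = T-C
rowTable (suc (suc (suc n))) = alternating n

sideRows : (P : Table → Set) → P T-A → P T-C → P T-E → ∀ ι → P (rowTable (suc ι))
sideRows P pA pC pE zero          = pA
sideRows P pA pC pE (suc zero)    = pC
sideRows P pA pC pE (suc (suc n)) = alternate n
  where
  alternate : ∀ n → P (alternating n)
  alternate zero          = pE
  alternate (suc zero)    = pA
  alternate (suc (suc n)) = alternate n

allRows : (P : Table → Set) → P T-B → P T-A → P T-C → P T-E → ∀ ι → P (rowTable ι)
allRows P pB pA pC pE zero    = pB
allRows P pB pA pC pE (suc ι) = sideRows P pA pC pE ι

rowTable-injective : ∀ ι → Injectiveᵀ (rowTable ι)
rowTable-injective = allRows Injectiveᵀ
  (from-yes (injectiveᵀ? T-B)) (from-yes (injectiveᵀ? T-A))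
  (from-yes (injectiveᵀ? T-C)) (from-yes (injectiveᵀ? T-E))

rowTable-rowsVanish : ∀ ι → RowsVanish (rowTable ι)
rowTable-rowsVanish = allRows RowsVanish
  (from-yes (rowsVanish? T-B)) (from-yes (rowsVanish? T-A))
  (from-yes (rowsVanish? T-C)) (from-yes (rowsVanish? T-E))

rowTable-sameHalf : ∀ ι ι' {k j k' j'} →
                    rowTable (suc ι) k j ≡ rowTable (suc ι') k' j' → isLeft j ≡ isLeft j'
rowTable-sameHalf ι ι' {k} {j} {k'} {j'} eq =
  trans (sym (leftHalf ι k j)) (trans (cong inL eq) (leftHalf ι' k' j'))
  where
  leftHalf : ∀ ι → LeftHalfIsL (rowTable (suc ι))
  leftHalf = sideRows LeftHalfIsL
    (from-yes (leftHalfIsL? T-A)) (from-yes (leftHalfIsL? T-C)) (from-yes (leftHalfIsL? T-E))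

ΣH-alternating : ∀ t k j → ΣH (2 * t) (λ i → alternating (toℕ i) k j) ≡ 0H
ΣH-alternating zero    k j = refl
ΣH-alternating (suc t) k j = begin
  ΣH (2 * suc t) (λ i → alternating (toℕ i) k j)
    ≡⟨ cong (λ n → ΣH n (λ i → alternating (toℕ i) k j)) (*-suc 2 t) ⟩
  T-E k j +H (T-A k j +H ΣH (2 * t) (λ i → alternating (toℕ i) k j))
    ≡⟨ cong (λ s → T-E k j +H (T-A k j +H s)) (ΣH-alternating t k j) ⟩
  T-E k j +H (T-A k j +H 0H)
    ≡⟨ cong (T-E k j +H_) (+H-identityʳ (T-A k j)) ⟩
  T-E k j +H T-A k j
    ≡⟨ E+A≡0 k j ⟩
  0H
    ∎
  where open ≡-Reasoning

ΣH-column : ∀ t k j → ΣH (3 + 2 * t) (λ i → rowTable (toℕ i) k j) ≡ 0H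
ΣH-column t k j = begin
  T-B k j +H (T-A k j +H (T-C k j +H ΣH (2 * t) (λ i → alternating (toℕ i) k j)))
    ≡⟨ cong (λ s → T-B k j +H (T-A k j +H (T-C k j +H s))) (ΣH-alternating t k j) ⟩
  T-B k j +H (T-A k j +H (T-C k j +H 0H))
    ≡⟨ cong (λ s → T-B k j +H (T-A k j +H s)) (+H-identityʳ (T-C k j)) ⟩
  T-B k j +H (T-A k j +H T-C k j)
    ≡⟨ B+A+C≡0 k j ⟩
  0H
    ∎
  where open ≡-Reasoning

-- r ∸ ι stands for −ι in ℤ_r; for ι = 0 it is r, which is 0 only modulo r.
offset : ℕ → Bool → ℕ → ℕ
offset r true  ι = ι
offset r false ι = r ∸ ι

∑-offset-row : ∀ r ι → ι ≤ r → ∑ 8 (λ j → offset r (isLeft j) ι) ≡ 4 * r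
∑-offset-row r ι ι≤r = trans (eight ι (r ∸ ι)) (cong (4 *_) (m+[n∸m]≡n ι≤r))
  where
  eight : ∀ a b → a + (a + (a + (a + (b + (b + (b + (b + 0))))))) ≡ 4 * (a + b)
  eight = solve-∀

∣∑-offset-column : ∀ r b → r % 2 ≡ 1 → r ∣ ∑ r (λ i → offset r b (toℕ i))
∣∑-offset-column r true  r-odd = odd⇒∣∑toℕ r r-odd
∣∑-offset-column r false r-odd = odd⇒∣∑∸toℕ r r-odd

offset-zero : ∀ n b → offset (suc n) b 0 % suc n ≡ 0
offset-zero n true  = refl
offset-zero n false = n%n≡0 (suc n)

offset-suc-bounds : ∀ {n} b {ι} → ι < n →
                    0 < offset (suc n) b (suc ι) × offset (suc n) b (suc ι) < suc n
offset-suc-bounds true          ι<n = z<s , s≤s ι<n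
offset-suc-bounds {n} false {ι} ι<n = m<n⇒0<n∸m ι<n , s≤s (m∸n≤m n ι)

offset-suc-mod : ∀ {n} b {ι} → ι < n → offset (suc n) b (suc ι) % suc n ≡ offset (suc n) b (suc ι)
offset-suc-mod b ι<n = m<n⇒m%n≡m (proj₂ (offset-suc-bounds b ι<n))

offset-zero≢suc : ∀ {n} b b' {ι} → ι < n →
                  offset (suc n) b 0 % suc n ≢ offset (suc n) b' (suc ι) % suc n
offset-zero≢suc {n} b b' ι<n eq =
  <⇒≢ (proj₁ (offset-suc-bounds b' ι<n)) (trans (sym (offset-zero n b)) (trans eq (offset-suc-mod b' ι<n)))

offset-suc-injective : ∀ {n} b {ι ι'} → ι < n → ι' < n →
                       offset (suc n) b (suc ι) % suc n ≡ offset (suc n) b (suc ι') % suc n → ι ≡ ι'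
offset-suc-injective b ι<n ι'<n eq
  with b | trans (sym (offset-suc-mod b ι<n)) (trans eq (offset-suc-mod b ι'<n))
... | true  | eq' = suc-injective eq'
... | false | eq' = ∸-cancelˡ-≡ (<⇒≤ ι<n) (<⇒≤ ι'<n) eq'

module Construction (t : ℕ) (r-odd : (3 + 2 * t) % 2 ≡ 1) where

  open Embedding (2 + 2 * t)

  array : Fin 2 → Fin r → Fin 8 → Γ r
  array k i j = embed (offset r (isLeft j) (toℕ i)) (rowTable (toℕ i) k j)

  array-rowSum : ∀ k i → ΣΓ r 8 (λ j → array k i j) ≡ 0Γ r
  array-rowSum k i = begin
    ΣΓ r 8 (λ j → array k i j)
      ≡⟨ ΣΓ-embed 8 (λ j → offset r (isLeft j) (toℕ i)) (rowTable (toℕ i) k) ⟩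
    embed (∑ 8 (λ j → offset r (isLeft j) (toℕ i))) (ΣH 8 (rowTable (toℕ i) k))
      ≡⟨ cong₂ embed (∑-offset-row r (toℕ i) (<⇒≤ (Fin.toℕ<n i)))
                     (rowTable-rowsVanish (toℕ i) k) ⟩
    embed (4 * r) 0H
      ≡⟨ embed-vanishes (n∣m*n 4) ⟩
    0Γ r
      ∎
    where open ≡-Reasoning

  array-colSum : ∀ k j → ΣΓ r r (λ i → array k i j) ≡ 0Γ r
  array-colSum k j = begin
    ΣΓ r r (λ i → array k i j)
      ≡⟨ ΣΓ-embed r (λ i → offset r (isLeft j) (toℕ i)) (λ i → rowTable (toℕ i) k j) ⟩
    embed (∑ r (λ i → offset r (isLeft j) (toℕ i))) (ΣH r (λ i → rowTable (toℕ i) k j))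
      ≡⟨ cong (embed (∑ r (λ i → offset r (isLeft j) (toℕ i)))) (ΣH-column t k j) ⟩
    embed (∑ r (λ i → offset r (isLeft j) (toℕ i))) 0H
      ≡⟨ embed-vanishes (∣∑-offset-column r (isLeft j) r-odd) ⟩
    0Γ r
      ∎
    where open ≡-Reasoning

  Cell : Set
  Cell = Fin 2 × Fin r × Fin 8

  cell : Cell → Γ r
  cell (k , i , j) = array k i j

  cells-separated : ∀ {k : Fin 2} {i : Fin r} {j : Fin 8} {k' : Fin 2} {i' : Fin r} {j' : Fin 8} →
                    offset r (isLeft j) (toℕ i) % r ≡ offset r (isLeft j') (toℕ i') % r →
                    rowTable (toℕ i) k j ≡ rowTable (toℕ i') k' j' → (k , i , j) ≡ (k' , i' , j')
  cells-separated {k} {zero} {j} {k'} {zero} {j'} _ eqT =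
    triple-≡ refl (rowTable-injective 0 k j k' j' eqT)
  cells-separated {i = zero} {j} {i' = suc i'} {j'} eqZ _ =
    ⊥-elim (offset-zero≢suc (isLeft j) (isLeft j') (Fin.toℕ<n i') eqZ)
  cells-separated {i = suc i} {j} {i' = zero} {j'} eqZ _ =
    ⊥-elim (offset-zero≢suc (isLeft j') (isLeft j) (Fin.toℕ<n i) (sym eqZ))
  cells-separated {k} {suc i} {j} {k'} {suc i'} {j'} eqZ eqT =
    triple-≡ (cong suc i≡i') (rowTable-injective (suc (toℕ i)) k j k' j' eqT′)
    where
    sameHalf : isLeft j ≡ isLeft j'
    sameHalf = rowTable-sameHalf (toℕ i) (toℕ i') eqT
    i≡i' : i ≡ i'
    i≡i' = Fin.toℕ-injective (offset-suc-injective (isLeft j) (Fin.toℕ<n i) (Fin.toℕ<n i')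
             (subst (λ b → offset r (isLeft j) (suc (toℕ i)) % r ≡ offset r b (suc (toℕ i')) % r)
                    (sym sameHalf) eqZ))
    eqT′ : rowTable (suc (toℕ i)) k j ≡ rowTable (suc (toℕ i)) k' j'
    eqT′ = subst (λ x → rowTable (suc (toℕ i)) k j ≡ rowTable (suc (toℕ x)) k' j') (sym i≡i') eqT

  cell-injective : Injective _≡_ _≡_ cell
  cell-injective {k , i , j} {k' , i' , j'} eq = uncurry cells-separated (embed-injective r-odd
    {offset r (isLeft j) (toℕ i)} {offset r (isLeft j') (toℕ i')}
    {rowTable (toℕ i) k j} {rowTable (toℕ i') k' j'} eq)

  cell-surjective : Surjective _≡_ _≡_ cell
  cell-surjective =
    injective⇒surjective {f = cell} Fin³↔ (subst (λ n → Γ r ↔ Fin n) (sizes r) Fin³↔) cell-injective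
    where
    sizes : ∀ r → 2 * r * (2 * 4) ≡ 2 * (r * 8)
    sizes = solve-∀

  mrs : ZeroSumMRS r r 8 2
  mrs = record
    { arr       = array
    ; bijective = cell-injective , cell-surjective
    ; rowSum    = array-rowSum
    ; colSum    = array-colSum
    }

odd⇒≡3+2* : ∀ {r} → 3 ≤ r → r % 2 ≡ 1 → ∃[ t ] r ≡ 3 + 2 * t
odd⇒≡3+2* {r} 3≤r r-odd with r / 2 | odd⇒≡1+[n/2]*2 r r-odd
... | zero  | refl = contradiction 3≤r λ { (s≤s ()) }
... | suc t | eq   = t , trans eq (shape t)
  where
  shape : ∀ t → 1 + suc t * 2 ≡ 3 + 2 * t
  shape = solve-∀

lemma4p9 : (r : ℕ) .{{_ : NonZero r}} → 3 ≤ r → r % 2 ≡ 1 → ZeroSumMRS r r 8 2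
lemma4p9 r 3≤r r-odd with t , refl ← odd⇒≡3+2* 3≤r r-odd = Construction.mrs t r-odd
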